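{- Let $\sigma\in Av(T_1)$ and suppose $\Phi_1(\sigma)=P'P''$, where $P'$ is a nonempty Dyck path and $P''$ is any (possibly empty) Dyck prefix. Let $\tau=\Phi_1^{ -1}(P')$ and $\rho=\Phi_1^{ -1}(P'')$. Then $asc(\sigma)=asc(\tau)+asc(\rho)$.
   Context: A permutation $\sigma$ avoids $\tau$ if no subsequence of $\sigma$ has the same relative order as $\tau$. $T_1=\{3214,3241,4213,4231\}$, $Av(T_1)$ is the set of permutations avoiding all four patterns, $S_n(T_1)=Av(T_1)\cap S_n$. $asc(\sigma)$ is the number of positions $i$ with $\sigma(i)<\sigma(i+1)$. A Dyck prefix is a lattice path from the origin with steps $U=(1,1)$, $D=(1,-1)$ never going below the $x$-axis; a Dyck path is one ending on the $x$-axis. The map $\Phi_1$ on $Av(T_1)$: $\Phi_1(1)$ is the empty path; for $n\ge1$ and $\sigma\in S_{n+1}(T_1)$, write $\sigma=M_1w_1\cdots M_kw_k$ with $M_1<\cdots<M_k=n+1$ the left-to-right maxima (entries larger than all preceding ones) and $w_i$ possibly empty words of lengths $l_i$, $M_0=0$. If $w_k$ is empty, $\Phi_1(\sigma)=U^{M_1-M_0}D^{l_1+1}\cdots U^{M_{k-1}-M_{k-2}}D^{l_{k-1}+1}$; if $w_k=x_1\cdots x_{l_k}$ is nonempty, $\Phi_1(\sigma)=U^{M_1-M_0}D^{l_1+1}\cdots U^{M_{k-1}-M_{k-2}}D^{l_{k-1}+1}U^{M_k-M_{k-1}}Q_1\cdots Q_{l_k-1}$ with $Q_j=U$ if $x_j=\max\{x_j,\dots,x_{l_k}\}$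 and $Q_j=D$ otherwise. $\Phi_1$ is a bijection from $Av(T_1)$ onto the set of Dyck prefixes of even length, and $\Phi_1^{ -1}$ denotes its inverse. -}

module Defs where

open import Data.Nat using (ℕ; zero; suc; _+_; _∸_; _<_; _≤_; _<ᵇ_; _≤ᵇ_)
open import Data.Bool using (Bool; true; false; if_then_else_)
open import Data.List using (List; []; _∷_; _++_; length; map; upTo; replicate; zip)
open import Data.List.Relation.Binary.Sublist.Propositional using (_⊆_)
open import Data.List.Relation.Binary.Permutation.Propositional using (_↭_)
open import Data.List.Relation.Unary.All using (All)
open import Data.Product using (_×_; _,_; Σ; ∃; proj₂)
open import Function.Bundles using (_⇔_)
open import Relation.Nullary using (¬_)

IsPerm : List ℕ → Set
IsPerm σ = σ ↭ map suc (upTo (length σ))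

SameOrder : List ℕ → List ℕ → Set
SameOrder [] [] = Data.Unit.⊤
  where import Data.Unit
SameOrder [] (_ ∷ _) = Data.Empty.⊥
  where import Data.Empty
SameOrder (_ ∷ _) [] = Data.Empty.⊥
  where import Data.Empty
SameOrder (x ∷ xs) (y ∷ ys) =
  All (λ p → ((x < Data.Product.proj₁ p) ⇔ (y < proj₂ p))
           × ((Data.Product.proj₁ p < x) ⇔ (proj₂ p < y)))
      (zip xs ys)
  × SameOrder xs ys

Contains : List ℕ → List ℕ → Set
Contains σ τ = Σ (List ℕ) (λ s → (s ⊆ σ) × SameOrder s τ)

Avoids : List ℕ → List ℕ → Set
Avoids σ τ = ¬ Contains σ τ

T₁ : List (List ℕ)
T₁ = (3 ∷ 2 ∷ 1 ∷ 4 ∷ []) ∷ (3 ∷ 2 ∷ 4 ∷ 1 ∷ []) ∷ (4 ∷ 2 ∷ 1 ∷ 3 ∷ [])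
   ∷ (4 ∷ 2 ∷ 3 ∷ 1 ∷ []) ∷ []

InAvT₁ : List ℕ → Set
InAvT₁ σ = IsPerm σ × All (Avoids σ) T₁

asc : List ℕ → ℕ
asc [] = 0
asc (x ∷ []) = 0
asc (x ∷ y ∷ ys) = (if x <ᵇ y then 1 else 0) + asc (y ∷ ys)

data Step : Set where
  U D : Step

data PrefixFrom : ℕ → List Step → Set where
  nil   : ∀ {h} → PrefixFrom h []
  up    : ∀ {h p} → PrefixFrom (suc h) p → PrefixFrom h (U ∷ p)
  down  : ∀ {h p} → PrefixFrom h p → PrefixFrom (suc h) (D ∷ p)

data DyckFrom : ℕ → List Step → Set where
  nil   : DyckFrom 0 []
  up    : ∀ {h p} → DyckFrom (suc h) p → DyckFrom h (U ∷ p)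
  down  : ∀ {h p} → DyckFrom h p → DyckFrom (suc h) (D ∷ p)

IsDyckPrefix : List Step → Set
IsDyckPrefix = PrefixFrom 0

IsDyckPath : List Step → Set
IsDyckPath = DyckFrom 0

markLRmax : ℕ → List ℕ → List (Bool × ℕ)
markLRmax m [] = []
markLRmax m (x ∷ xs) with m <ᵇ x
... | true  = (true , x) ∷ markLRmax x xs
... | false = (false , x) ∷ markLRmax m xs

-- group into blocks (M_i , w_i); the leading word (before M₁) is empty
-- for permutations and is discarded
group : List (Bool × ℕ) → List ℕ × List (ℕ × List ℕ)
group [] = [] , []
group ((b , x) ∷ xs) with group xs
... | w , bs = if b then ([] , (x , w) ∷ bs) else (x ∷ w , bs)

blocks : List ℕ → List (ℕ × List ℕ)
blocks σ = proj₂ (group (markLRmax 0 σ))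

geqAll : ℕ → List ℕ → Bool
geqAll x [] = true
geqAll x (z ∷ zs) = if z ≤ᵇ x then geqAll x zs else false

Qs : List ℕ → List Step
Qs [] = []
Qs (x ∷ []) = []
Qs (x ∷ y ∷ ys) =
  (if geqAll x (y ∷ ys) then U else D) ∷ Qs (y ∷ ys)

-- argument prev = M_{i-1}
phiBlocks : ℕ → List (ℕ × List ℕ) → List Step
phiBlocks prev [] = []
phiBlocks prev ((M , []) ∷ []) = []
phiBlocks prev ((M , (x ∷ xs)) ∷ []) = replicate (M ∸ prev) U ++ Qs (x ∷ xs)
phiBlocks prev ((M , w) ∷ (b ∷ bs)) =
  replicate (M ∸ prev) U ++ replicate (suc (length w)) D ++ phiBlocks M (b ∷ bs)

Φ₁ : List ℕ → List Step
Φ₁ σ = phiBlocks 0 (blocks σ)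

module Submission where

-- Write σ = M₁w₁⋯M_kw_k by left-to-right maxima.  Avoiding 3214 forces
-- every word w_i with i < k to be increasing, so the segment M_iw_iM_{i+1} has
-- max(1, |w_i|) ascents; avoiding 4213 forces the ascents of w_k to be exactly
-- the D steps of Q₁⋯Q_{l_k-1}.  Hence asc σ can be read off the path Φ₁(σ) by a
-- left-to-right scan, 'pathAsc', which counts every D of a descent run except
-- the second one until the |σ| up steps coming from the maxima are used up, and
-- every D afterwards.  Such a scan is additive over P′ ++ P″ as soon as its
-- budget of up steps exceeds the up steps of P′, and the budgets of σ, τ, ρ
-- are matched because |Φ₁ π| + 2 = 2|π| and a Dyck path has as many U as D.

open import Defs
open import Data.Nat using (ℕ; zero; suc; _+_; _∸_; _⊔_; _≤_; _<_; _<ᵇ_; _≤ᵇ_; z≤n; s≤s)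
open import Data.Nat.Properties
open import Data.Nat.Tactic.RingSolver using (solve-∀)
open import Data.Bool using (true; false; T)
open import Data.List using (List; []; _∷_; _++_; length; replicate)
open import Data.List.Properties using (length-++; ++-identityʳ)
open import Data.List.Relation.Unary.All as All using (All; []; _∷_)
import Data.List.Relation.Unary.All.Properties as Allₚ
open import Data.List.Relation.Unary.Any using (here; there)
open import Data.List.Relation.Unary.Linked using (Linked; []; [-]; _∷_)
open import Data.List.Relation.Unary.AllPairs using ([]; _∷_)
open import Data.List.Relation.Unary.Unique.Propositional using (Unique)
import Data.List.Relation.Unary.Unique.Propositional.Properties as Unique
open import Data.List.Membership.Propositional using (_∈_)
open import Data.List.Membership.Propositional.Properties
  using (∈-map⁻; ∈-map⁺; ∈-upTo⁺; ∈-upTo⁻; ∈-++⁻; ∈-++⁺ʳ)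
open import Data.List.Relation.Binary.Permutation.Propositional using (↭-sym; ↭⇒↭ₛ)
open import Data.List.Relation.Binary.Permutation.Propositional.Properties using (Any-resp-↭)
open import Data.List.Relation.Binary.Permutation.Setoid.Properties as ↭ₛ using ()
open import Data.List.Relation.Binary.Sublist.Propositional
  using (_⊆_; []; _∷_; _∷ʳ_; ⊆-refl; ⊆-trans; from∈)
open import Data.List.Relation.Binary.Sublist.Propositional.Properties using (++⁺; ++⁺ˡ; ++⁺ʳ; All-resp-⊆)
open import Data.Product using (_×_; _,_; ∃; proj₁; proj₂)
open import Data.Sum using (inj₁; inj₂)
open import Data.Empty using (⊥-elim)
open import Data.Unit using (tt)
open import Function.Bundles using (_⇔_; mk⇔)
open import Relation.Nullary using (¬_)
open import Relation.Nullary.Reflects using (Reflects; ofʸ; ofⁿ; det)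
open import Relation.Binary using (tri<; tri≈; tri>)
open import Relation.Binary.PropositionalEquality
  using (_≡_; _≢_; refl; sym; trans; cong; cong₂; subst; setoid; module ≡-Reasoning)

reflects-true : ∀ {A : Set} {b} → Reflects A b → A → b ≡ true
reflects-true r a = det r (ofʸ a)

reflects-false : ∀ {A : Set} {b} → Reflects A b → ¬ A → b ≡ false
reflects-false r ¬a = det r (ofⁿ ¬a)

<ᵇ-true : ∀ {m n} → m < n → (m <ᵇ n) ≡ true
<ᵇ-true {m} {n} = reflects-true (<ᵇ-reflects-< m n)

<ᵇ-false : ∀ {m n} → n ≤ m → (m <ᵇ n) ≡ false
<ᵇ-false {m} {n} n≤m = reflects-false (<ᵇ-reflects-< m n) (≤⇒≯ n≤m)

≤ᵇ-true : ∀ {m n} → m ≤ n → (m ≤ᵇ n) ≡ true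
≤ᵇ-true {m} {n} = reflects-true (≤ᵇ-reflects-≤ m n)

≤ᵇ-false : ∀ {m n} → n < m → (m ≤ᵇ n) ≡ false
≤ᵇ-false {m} {n} n<m = reflects-false (≤ᵇ-reflects-≤ m n) (<⇒≱ n<m)

-- (1) Reading ascents off a path

ups : List Step → ℕ
ups []      = 0
ups (U ∷ P) = suc (ups P)
ups (D ∷ P) = ups P

downs : List Step → ℕ
downs []      = 0
downs (U ∷ P) = downs P
downs (D ∷ P) = suc (downs P)

length-ups-downs : ∀ P → length P ≡ ups P + downs P
length-ups-downs []      = refl
length-ups-downs (U ∷ P) = cong suc (length-ups-downs P)
length-ups-downs (D ∷ P) = trans (cong suc (length-ups-downs P)) (sym (+-suc (ups P) (downs P)))

dyck-downs : ∀ {h P} → DyckFrom h P → downs P ≡ h + ups P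
dyck-downs nil        = refl
dyck-downs {h} (up d) = trans (dyck-downs d) (sym (+-suc h _))
dyck-downs (down d)   = cong suc (dyck-downs d)

dyck-length : ∀ {P} → IsDyckPath P → length P ≡ ups P + ups P
dyck-length {P} d = trans (length-ups-downs P) (cong (ups P +_) (dyck-downs d))

-- Position inside a run of down steps: right after an up step, after exactly
-- one down step, or after at least two.
data Phase : Set where
  peak one deep : Phase

-- pathAsc c φ P scans P in phase φ while c up steps (the growth of the
-- left-to-right maxima) remain: every D of a descent run except the second one
-- counts, matching the max(1,|w|) ascents of a segment M w M′ with w increasing.
-- Once the budget c is exhausted, the rest is Q₁⋯Q_{l_k-1} and every D counts.
pathAsc : ℕ → Phase → List Step → ℕ
pathAsc zero    _    P       = downs P
pathAsc (suc c) _    []      = 0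
pathAsc (suc c) _    (U ∷ P) = pathAsc c peak P
pathAsc (suc c) peak (D ∷ P) = suc (pathAsc (suc c) one P)
pathAsc (suc c) one  (D ∷ P) = pathAsc (suc c) deep P
pathAsc (suc c) deep (D ∷ P) = suc (pathAsc (suc c) deep P)

pathAsc-[] : ∀ c φ → pathAsc c φ [] ≡ 0
pathAsc-[] zero    φ = refl
pathAsc-[] (suc c) φ = refl

-- Paths that are empty or begin with an up step; the phase does not matter for them.
data StartsUp : List Step → Set where
  flat  : StartsUp []
  rises : ∀ {P} → StartsUp (U ∷ P)

prefix-startsUp : ∀ {P} → IsDyckPrefix P → StartsUp P
prefix-startsUp nil    = flat
prefix-startsUp (up _) = rises

pathAsc-phase : ∀ c φ ψ {P} → StartsUp P → pathAsc (suc c) φ P ≡ pathAsc (suc c) ψ P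
pathAsc-phase c φ ψ flat  = refl
pathAsc-phase c φ ψ rises = refl

pathAsc-++ : ∀ P′ c φ {P″} → StartsUp P″ →
  pathAsc (suc (ups P′ + c)) φ (P′ ++ P″) ≡ pathAsc (suc (ups P′)) φ P′ + pathAsc (suc c) peak P″
pathAsc-++ []      c φ    s = pathAsc-phase c φ peak s
pathAsc-++ (U ∷ P) c φ    s = pathAsc-++ P c peak s
pathAsc-++ (D ∷ P) c peak s = cong suc (pathAsc-++ P c one s)
pathAsc-++ (D ∷ P) c one  s = pathAsc-++ P c deep s
pathAsc-++ (D ∷ P) c deep s = cong suc (pathAsc-++ P c deep s)

pathAsc-climb : ∀ a c φ Y → pathAsc (suc a + c) φ (replicate (suc a) U ++ Y) ≡ pathAsc c peak Y
pathAsc-climb zero    c φ Y = refl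
pathAsc-climb (suc a) c φ Y = pathAsc-climb a c peak Y

pathAsc-climb-all : ∀ a φ Y → pathAsc (suc a) φ (replicate (suc a) U ++ Y) ≡ downs Y
pathAsc-climb-all a φ Y =
  trans (cong (λ c → pathAsc c φ (replicate (suc a) U ++ Y)) (sym (+-identityʳ (suc a)))) (pathAsc-climb a 0 φ Y)

pathAsc-deep : ∀ l c Y → pathAsc (suc c) deep (replicate l D ++ Y) ≡ l + pathAsc (suc c) deep Y
pathAsc-deep zero    c Y = refl
pathAsc-deep (suc l) c Y = cong suc (pathAsc-deep l c Y)

pathAsc-descent : ∀ l c {Y} → StartsUp Y →
  pathAsc (suc c) peak (replicate (suc l) D ++ Y) ≡ 1 ⊔ l + pathAsc (suc c) peak Y
pathAsc-descent zero    c     s = cong suc (pathAsc-phase c one peak s)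
pathAsc-descent (suc l) c {Y} s =
  cong suc (trans (pathAsc-deep l c Y) (cong (l +_) (pathAsc-phase c deep peak s)))

-- (2) Decomposition into left-to-right maxima

Blocks : Set
Blocks = List (ℕ × List ℕ)

flatten : Blocks → List ℕ
flatten []             = []
flatten ((M , w) ∷ bs) = M ∷ w ++ flatten bs

data Decomp : ℕ → Blocks → Set where
  []    : ∀ {m} → Decomp m []
  block : ∀ {m M w bs} → m < M → All (_≤ M) w → Decomp M bs → Decomp m ((M , w) ∷ bs)

lastMax : ℕ → Blocks → ℕ
lastMax m []             = m
lastMax m ((M , _) ∷ bs) = lastMax M bs

group-spec : ∀ m σ → let g = group (markLRmax m σ) in
  (σ ≡ proj₁ g ++ flatten (proj₂ g)) × All (_≤ m) (proj₁ g) × Decomp m (proj₂ g)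
group-spec m [] = refl , [] , []
group-spec m (x ∷ xs) with m <ᵇ x | <ᵇ-reflects-< m x
... | true  | ofʸ m<x = let (e , below , d) = group-spec x xs in cong (x ∷_) e , [] , block m<x below d
... | false | ofⁿ m≮x = let (e , below , d) = group-spec m xs in cong (x ∷_) e , ≮⇒≥ m≮x ∷ below , d

lastMax-≥ : ∀ {m bs} → Decomp m bs → m ≤ lastMax m bs
lastMax-≥ []              = ≤-refl
lastMax-≥ (block m<M _ d) = ≤-trans (<⇒≤ m<M) (lastMax-≥ d)

lastMax-> : ∀ {m b bs} → Decomp m (b ∷ bs) → m < lastMax m (b ∷ bs)
lastMax-> (block m<M _ d) = <-≤-trans m<M (lastMax-≥ d)

lastMax-∈ : ∀ m b bs → lastMax m (b ∷ bs) ∈ flatten (b ∷ bs)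
lastMax-∈ m (M , w) []       = here refl
lastMax-∈ m (M , w) (b ∷ bs) = there (∈-++⁺ʳ w (lastMax-∈ M b bs))

lastMax-bounds : ∀ {m bs} → Decomp m bs → All (_≤ lastMax m bs) (flatten bs)
lastMax-bounds []               = []
lastMax-bounds (block _ below d) =
  lastMax-≥ d ∷ Allₚ.++⁺ (All.map (λ x≤M → ≤-trans x≤M (lastMax-≥ d)) below) (lastMax-bounds d)

-- (3) Consequences of avoiding 3214 and 4213

p3214 p4213 : List ℕ
p3214 = 3 ∷ 2 ∷ 1 ∷ 4 ∷ []
p4213 = 4 ∷ 2 ∷ 1 ∷ 3 ∷ []

avoids-⊆ : ∀ {xs ys τ} → xs ⊆ ys → Avoids ys τ → Avoids xs τ
avoids-⊆ xs⊆ys av (s , s⊆xs , same) = av (s , ⊆-trans s⊆xs xs⊆ys , same)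

unique-⊆ : ∀ {xs ys : List ℕ} → xs ⊆ ys → Unique ys → Unique xs
unique-⊆ []          []        = []
unique-⊆ (_ ∷ʳ xs⊆ys) (_ ∷ u)   = unique-⊆ xs⊆ys u
unique-⊆ (refl ∷ xs⊆ys) (x≢ ∷ u) = All-resp-⊆ xs⊆ys x≢ ∷ unique-⊆ xs⊆ys u

record Admissible (xs : List ℕ) : Set where
  field
    distinct : Unique xs
    no3214   : Avoids xs p3214
    no4213   : Avoids xs p4213

admissible-⊆ : ∀ {xs ys} → xs ⊆ ys → Admissible ys → Admissible xs
admissible-⊆ xs⊆ys a = record
  { distinct = unique-⊆ xs⊆ys distinct
  ; no3214   = avoids-⊆ xs⊆ys no3214
  ; no4213   = avoids-⊆ xs⊆ys no4213
  }
  where open Admissible a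

num< : ∀ m n → {T (m <ᵇ n)} → m < n
num< m n {m<n} = <ᵇ⇒< m n m<n

agree< : ∀ {x y p q} → x < y → p < q → ((x < y) ⇔ (p < q)) × ((y < x) ⇔ (q < p))
agree< x<y p<q =
    mk⇔ (λ _ → p<q) (λ _ → x<y)
  , mk⇔ (λ y<x → ⊥-elim (<-asym x<y y<x)) (λ q<p → ⊥-elim (<-asym p<q q<p))

agree> : ∀ {x y p q} → y < x → q < p → ((x < y) ⇔ (p < q)) × ((y < x) ⇔ (q < p))
agree> y<x q<p =
    mk⇔ (λ x<y → ⊥-elim (<-asym y<x x<y)) (λ p<q → ⊥-elim (<-asym q<p p<q))
  , mk⇔ (λ _ → q<p) (λ _ → y<x)

occurrence-3214 : ∀ {M a b K} → b < a → a < M → M < K → SameOrder (M ∷ a ∷ b ∷ K ∷ []) p3214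
occurrence-3214 b<a a<M M<K =
    (agree> a<M (num< 2 3) ∷ agree> (<-trans b<a a<M) (num< 1 3) ∷ agree< M<K (num< 3 4) ∷ [])
  , (agree> b<a (num< 1 2) ∷ agree< (<-trans a<M M<K) (num< 2 4) ∷ [])
  , (agree< (<-trans b<a (<-trans a<M M<K)) (num< 1 4) ∷ [])
  , [] , tt

occurrence-4213 : ∀ {K x y z} → y < x → x < z → z < K → SameOrder (K ∷ x ∷ y ∷ z ∷ []) p4213
occurrence-4213 y<x x<z z<K =
    ( agree> (<-trans x<z z<K) (num< 2 4) ∷ agree> (<-trans y<x (<-trans x<z z<K)) (num< 1 4)
    ∷ agree> z<K (num< 3 4) ∷ [])
  , (agree> y<x (num< 1 2) ∷ agree< x<z (num< 2 3) ∷ [])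
  , (agree< (<-trans y<x x<z) (num< 1 3) ∷ [])
  , [] , tt

increasing-between : ∀ {M K} w → All (_< M) w → M < K → Unique w →
  Avoids (M ∷ w ++ K ∷ []) p3214 → Linked _<_ w
increasing-between []          _                  _   _                 _  = []
increasing-between (a ∷ [])    _                  _   _                 _  = [-]
increasing-between (a ∷ b ∷ w) (a<M ∷ b<M ∷ w<M) M<K ((a≢b ∷ _) ∷ u) av with <-cmp a b
... | tri< a<b _ _ = a<b ∷ increasing-between (b ∷ w) (b<M ∷ w<M) M<K u (avoids-⊆ (refl ∷ a ∷ʳ ⊆-refl) av)
... | tri≈ _ a≡b _ = ⊥-elim (a≢b a≡b)
... | tri> _ _ b<a = ⊥-elim (av (_ , refl ∷ refl ∷ refl ∷ ++⁺ˡ w (refl ∷ []) , occurrence-3214 b<a a<M M<K))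

asc-increasing : ∀ a w y ys → Linked _<_ (a ∷ w) → All (_< y) (a ∷ w) →
  asc (a ∷ w ++ y ∷ ys) ≡ suc (length w) + asc (y ∷ ys)
asc-increasing a []      y ys [-]         (a<y ∷ []) rewrite <ᵇ-true a<y = refl
asc-increasing a (b ∷ w) y ys (a<b ∷ inc) (_ ∷ w<y)  rewrite <ᵇ-true a<b =
  cong suc (asc-increasing b w y ys inc w<y)

asc-block : ∀ {M M′} w rest → All (_≤ M) w → All (_< M′) w → M < M′ → Linked _<_ w →
  asc (M ∷ w ++ M′ ∷ rest) ≡ 1 ⊔ length w + asc (M′ ∷ rest)
asc-block []      rest _           _    M<M′ _   rewrite <ᵇ-true M<M′ = refl
asc-block (a ∷ w) rest (a≤M ∷ _) w<M′ _    inc rewrite <ᵇ-false a≤M = asc-increasing a w _ rest inc w<M′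

asc-drop : ∀ {M x xs} → x ≤ M → asc (M ∷ x ∷ xs) ≡ asc (x ∷ xs)
asc-drop x≤M rewrite <ᵇ-false x≤M = refl

exceeding-entry : ∀ {P : ℕ → Set} x ys → All P ys → geqAll x ys ≡ false → ∃ λ z → z ∈ ys × x < z × P z
exceeding-entry x (z ∷ zs) (pz ∷ pzs) e with z ≤ᵇ x | ≤ᵇ-reflects-≤ z x
... | false | ofⁿ z≰x = z , here refl , ≰⇒> z≰x , pz
... | true  | ofʸ _   =
  let (z′ , z′∈ , x<z′ , pz′) = exceeding-entry x zs pzs e in z′ , there z′∈ , x<z′ , pz′

-- Avoiding 4213 below a larger K, every descent x > y of w has x ≥ all later entries,
-- so the D steps of Q₁⋯Q_{l-1} are exactly the ascents of w.
final-word-ascents : ∀ {K} w → All (_< K) w → Unique w → Avoids (K ∷ w) p4213 → downs (Qs w) ≡ asc w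
final-word-ascents []          _                 _               _  = refl
final-word-ascents (x ∷ [])    _                 _               _  = refl
final-word-ascents (x ∷ y ∷ ys) (_ ∷ y<K ∷ w<K)   ((x≢y ∷ _) ∷ u) av with <-cmp x y
... | tri< x<y _ _ rewrite <ᵇ-true x<y | ≤ᵇ-false x<y =
  cong suc (final-word-ascents (y ∷ ys) (y<K ∷ w<K) u (avoids-⊆ (refl ∷ x ∷ʳ ⊆-refl) av))
... | tri≈ _ x≡y _ = ⊥-elim (x≢y x≡y)
... | tri> _ _ y<x with geqAll x ys in dominates
...   | false = let (z , z∈ys , x<z , z<K) = exceeding-entry x ys w<K dominates in
                ⊥-elim (av (_ , refl ∷ refl ∷ refl ∷ from∈ z∈ys , occurrence-4213 y<x x<z z<K))
...   | true rewrite <ᵇ-false (<⇒≤ y<x) | ≤ᵇ-true (<⇒≤ y<x) =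
  final-word-ascents (y ∷ ys) (y<K ∷ w<K) u (avoids-⊆ (refl ∷ x ∷ʳ ⊆-refl) av)

-- (4) The path of a decomposition

block-below : ∀ {M w r} → All (_≤ M) w → Unique (M ∷ w ++ r) → All (_< M) w
block-below {w = w} w≤M (M≢ ∷ _) =
  All.zipWith (λ (x≤M , M≢x) → ≤∧≢⇒< x≤M (λ x≡M → M≢x (sym x≡M))) (w≤M , Allₚ.++⁻ˡ w M≢)

phiBlocks-block : ∀ prev M w b bs → phiBlocks prev ((M , w) ∷ b ∷ bs) ≡
  replicate (M ∸ prev) U ++ replicate (suc (length w)) D ++ phiBlocks M (b ∷ bs)
phiBlocks-block prev M []      b bs = refl
phiBlocks-block prev M (_ ∷ _) b bs = refl

climb-length : ∀ {p M} → p < M → M ∸ p ≡ suc (M ∸ suc p)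
climb-length {zero}  {suc M} _         = refl
climb-length {suc p} {suc M} (s≤s p<M) = climb-length p<M

budget-split : ∀ {p M K} → p ≤ M → M ≤ K → K ∸ p ≡ (M ∸ p) + (K ∸ M)
budget-split {p} {M} {K} p≤M M≤K = begin
  K ∸ p               ≡⟨ cong (_∸ p) (sym (m∸n+n≡m M≤K)) ⟩
  (K ∸ M) + M ∸ p     ≡⟨ +-∸-assoc (K ∸ M) p≤M ⟩
  (K ∸ M) + (M ∸ p)   ≡⟨ +-comm (K ∸ M) (M ∸ p) ⟩
  (M ∸ p) + (K ∸ M)   ∎
  where open ≡-Reasoning

phiBlocks-startsUp : ∀ {prev b bs} → Decomp prev (b ∷ bs) → StartsUp (phiBlocks prev (b ∷ bs))
phiBlocks-startsUp {b = M , []}    {[]} _ = flat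
phiBlocks-startsUp {b = M , _ ∷ _} {[]} (block p<M _ _) rewrite climb-length p<M = rises
phiBlocks-startsUp {prev} {M , w} {b ∷ bs} (block p<M _ _)
  rewrite phiBlocks-block prev M w b bs | climb-length p<M = rises

asc-pathAsc : ∀ {prev} bs → Decomp prev bs → Admissible (flatten bs) →
  pathAsc (lastMax prev bs ∸ prev) peak (phiBlocks prev bs) ≡ asc (flatten bs)
asc-pathAsc {prev} [] _ _ = pathAsc-[] (prev ∸ prev) peak
asc-pathAsc ((M , []) ∷ []) (block p<M _ _) _ rewrite climb-length p<M = refl
asc-pathAsc {prev} ((M , x ∷ xs) ∷ []) (block p<M w≤M _) adm rewrite climb-length p<M = begin
  pathAsc (suc a) peak (replicate (suc a) U ++ Qs w) ≡⟨ pathAsc-climb-all a peak (Qs w) ⟩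
  downs (Qs w)                                       ≡⟨ final-word-ascents w w<M (unique-⊆ w⊆ distinct) no4213′ ⟩
  asc w                                              ≡⟨ cong asc (sym (++-identityʳ w)) ⟩
  asc (w ++ [])                                      ≡⟨ sym (asc-drop {xs = xs ++ []} (All.head w≤M)) ⟩
  asc (M ∷ w ++ [])                                  ∎
  where
  open ≡-Reasoning
  open Admissible adm
  w = x ∷ xs
  a = M ∸ suc prev
  w⊆ : w ⊆ M ∷ w ++ []
  w⊆ = M ∷ʳ ++⁺ʳ [] ⊆-refl
  w<M : All (_< M) w
  w<M = block-below w≤M distinct
  no4213′ : Avoids (M ∷ w) p4213
  no4213′ = avoids-⊆ (refl ∷ ++⁺ʳ [] ⊆-refl) no4213
asc-pathAsc {prev} ((M , w) ∷ (M′ , w′) ∷ bs) (block p<M w≤M d@(block M<M′ _ _)) adm = begin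
  pathAsc (K ∸ prev) peak (phiBlocks prev ((M , w) ∷ rest))
    ≡⟨ cong₂ (λ c P → pathAsc c peak P) budget path ⟩
  pathAsc (suc a + suc c) peak (replicate (suc a) U ++ replicate (suc (length w)) D ++ R)
    ≡⟨ pathAsc-climb a (suc c) peak _ ⟩
  pathAsc (suc c) peak (replicate (suc (length w)) D ++ R)
    ≡⟨ pathAsc-descent (length w) c (phiBlocks-startsUp d) ⟩
  1 ⊔ length w + pathAsc (suc c) peak R
    ≡⟨ cong (λ n → 1 ⊔ length w + pathAsc n peak R) (sym (climb-length M<K)) ⟩
  1 ⊔ length w + pathAsc (K ∸ M) peak R
    ≡⟨ cong (1 ⊔ length w +_) (asc-pathAsc rest d (admissible-⊆ (M ∷ʳ ++⁺ˡ w ⊆-refl) adm)) ⟩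
  1 ⊔ length w + asc (flatten rest)
    ≡⟨ sym (asc-block w _ w≤M w<M′ M<M′ increasing) ⟩
  asc (M ∷ w ++ flatten rest) ∎
  where
  open ≡-Reasoning
  open Admissible adm
  rest = (M′ , w′) ∷ bs
  R = phiBlocks M rest
  K = lastMax M′ bs
  M<K : M < K
  M<K = lastMax-> d
  a = M ∸ suc prev
  c = K ∸ suc M
  budget : K ∸ prev ≡ suc a + suc c
  budget = trans (budget-split (<⇒≤ p<M) (<⇒≤ M<K)) (cong₂ _+_ (climb-length p<M) (climb-length M<K))
  path : phiBlocks prev ((M , w) ∷ rest) ≡ replicate (suc a) U ++ replicate (suc (length w)) D ++ R
  path = trans (phiBlocks-block prev M w _ bs)
               (cong (λ n → replicate n U ++ replicate (suc (length w)) D ++ R) (climb-length p<M))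
  w<M : All (_< M) w
  w<M = block-below w≤M distinct
  w<M′ : All (_< M′) w
  w<M′ = All.map (λ x<M → <-trans x<M M<M′) w<M
  increasing : Linked _<_ w
  increasing = increasing-between w w<M M<K (unique-⊆ (M ∷ʳ ++⁺ʳ _ ⊆-refl) distinct)
    (avoids-⊆ (refl ∷ ++⁺ ⊆-refl (from∈ (lastMax-∈ M (M′ , w′) bs))) no3214)

finalReach : ℕ → ℕ → List ℕ → ℕ
finalReach prev M []      = suc prev
finalReach prev M (_ ∷ _) = M

reach : ℕ → Blocks → ℕ
reach prev []                 = prev
reach prev ((M , w) ∷ [])     = finalReach prev M w
reach prev ((M , _) ∷ b ∷ bs) = reach M (b ∷ bs)

length-replicate-++ : ∀ n (s : Step) ys → length (replicate n s ++ ys) ≡ n + length ys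
length-replicate-++ zero    s ys = refl
length-replicate-++ (suc n) s ys = cong suc (length-replicate-++ n s ys)

length-Qs : ∀ x xs → length (Qs (x ∷ xs)) ≡ length xs
length-Qs x []       = refl
length-Qs x (y ∷ ys) = cong suc (length-Qs y ys)

phiBlocks-length : ∀ {prev} b bs → Decomp prev (b ∷ bs) →
  length (phiBlocks prev (b ∷ bs)) + prev + 2 ≡ reach prev (b ∷ bs) + length (flatten (b ∷ bs))
phiBlocks-length {prev} (M , []) [] _ = +-suc prev 1
phiBlocks-length {prev} (M , x ∷ xs) [] (block p<M _ _) = begin
  length (replicate (M ∸ prev) U ++ Qs (x ∷ xs)) + prev + 2
    ≡⟨ cong (λ n → n + prev + 2)
            (trans (length-replicate-++ (M ∸ prev) U _) (cong (M ∸ prev +_) (length-Qs x xs))) ⟩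
  (M ∸ prev) + length xs + prev + 2
    ≡⟨ regroup (M ∸ prev) (length xs) prev ⟩
  (M ∸ prev) + prev + suc (suc (length xs))
    ≡⟨ cong₂ (λ m l → m + suc (suc l)) (m∸n+n≡m (<⇒≤ p<M)) (cong length (sym (++-identityʳ xs))) ⟩
  M + suc (suc (length (xs ++ [])))
    ∎
  where
  open ≡-Reasoning
  regroup : ∀ a l p → a + l + p + 2 ≡ a + p + suc (suc l)
  regroup = solve-∀
phiBlocks-length {prev} (M , w) (b ∷ bs) (block p<M _ d) = begin
  length (phiBlocks prev ((M , w) ∷ b ∷ bs)) + prev + 2
    ≡⟨ cong (λ n → n + prev + 2) (trans (cong length (phiBlocks-block prev M w b bs)) lengths) ⟩
  (M ∸ prev) + (suc (length w) + length R) + prev + 2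
    ≡⟨ regroup (M ∸ prev) (length w) (length R) prev ⟩
  suc (length w) + (length R + ((M ∸ prev) + prev) + 2)
    ≡⟨ cong (λ m → suc (length w) + (length R + m + 2)) (m∸n+n≡m (<⇒≤ p<M)) ⟩
  suc (length w) + (length R + M + 2)
    ≡⟨ cong (suc (length w) +_) (phiBlocks-length b bs d) ⟩
  suc (length w) + (reach M (b ∷ bs) + length F)
    ≡⟨ swap (length w) (reach M (b ∷ bs)) (length F) ⟩
  reach M (b ∷ bs) + suc (length w + length F)
    ≡⟨ cong (λ n → reach M (b ∷ bs) + suc n) (sym (length-++ w)) ⟩
  reach M (b ∷ bs) + suc (length (w ++ F))
    ∎
  where
  open ≡-Reasoning
  R = phiBlocks M (b ∷ bs)
  F = flatten (b ∷ bs)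
  lengths : length (replicate (M ∸ prev) U ++ replicate (suc (length w)) D ++ R)
            ≡ (M ∸ prev) + (suc (length w) + length R)
  lengths = trans (length-replicate-++ (M ∸ prev) U _)
                  (cong (M ∸ prev +_) (length-replicate-++ (suc (length w)) D R))
  regroup : ∀ a l r p → a + (suc l + r) + p + 2 ≡ suc l + (r + (a + p) + 2)
  regroup = solve-∀
  swap : ∀ l m f → suc l + (m + f) ≡ m + suc (l + f)
  swap = solve-∀

reach-> : ∀ {prev b bs} → Decomp prev (b ∷ bs) → prev < reach prev (b ∷ bs)
reach-> {b = M , []}    {[]}    _               = ≤-refl
reach-> {b = M , _ ∷ _} {[]}    (block p<M _ _) = p<M
reach-> {b = M , w}     {_ ∷ _} (block p<M _ d) = <-trans p<M (reach-> d)

reach-≤ : ∀ {prev b bs} → Decomp prev (b ∷ bs) → reach prev (b ∷ bs) ≤ lastMax prev (b ∷ bs)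
reach-≤ {b = M , []}    {[]}    (block p<M _ _) = p<M
reach-≤ {b = M , _ ∷ _} {[]}    _               = ≤-refl
reach-≤ {b = M , w}     {_ ∷ _} (block _ _ d)   = reach-≤ d

below-reach : ∀ {prev b bs y} → Decomp prev (b ∷ bs) → y ∈ flatten (b ∷ bs) →
  y ≢ lastMax prev (b ∷ bs) → y < reach prev (b ∷ bs)
below-reach {b = M , w} {[]} _ (here y≡M) y≢M = ⊥-elim (y≢M y≡M)
below-reach {b = M , []} {[]} _ (there ())
below-reach {b = M , x ∷ xs} {[]} (block _ w≤M _) (there y∈) y≢M with ∈-++⁻ (x ∷ xs) y∈
... | inj₁ y∈w = ≤∧≢⇒< (All.lookup w≤M y∈w) y≢M
... | inj₂ ()
below-reach {b = M , w} {_ ∷ _} (block _ _ d) (here refl) _ = reach-> d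
below-reach {b = M , w} {_ ∷ _} (block _ w≤M d) (there y∈) y≢K with ∈-++⁻ w y∈
... | inj₁ y∈w  = ≤-<-trans (All.lookup w≤M y∈w) (reach-> d)
... | inj₂ y∈bs = below-reach d y∈bs y≢K

-- (5) Permutations

perm-unique : ∀ {σ} → IsPerm σ → Unique σ
perm-unique {σ} p =
  ↭ₛ.Unique-resp-↭ (setoid ℕ) (↭⇒↭ₛ (↭-sym p)) (Unique.map⁺ suc-injective (Unique.upTo⁺ (length σ)))

perm-range : ∀ {σ x} → IsPerm σ → x ∈ σ → 1 ≤ x × x ≤ length σ
perm-range p x∈σ with ∈-map⁻ suc (Any-resp-↭ p x∈σ)
... | i , i∈ , refl = s≤s z≤n , ∈-upTo⁻ i∈

perm-complete : ∀ {σ i} → IsPerm σ → i < length σ → suc i ∈ σ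
perm-complete p i<n = Any-resp-↭ (↭-sym p) (∈-map⁺ suc (∈-upTo⁺ i<n))

perm-max : ∀ {σ} → IsPerm σ → 1 ≤ length σ → length σ ∈ σ
perm-max {σ} p len = subst (_∈ σ) size (perm-complete p (≤-reflexive size))
  where
  size : suc (length σ ∸ 1) ≡ length σ
  size = m+[n∸m]≡n len

-- Entries of a permutation are positive, so nothing precedes the first maximum.
perm-blocks : ∀ {σ} → IsPerm σ → σ ≡ flatten (blocks σ)
perm-blocks {σ} p = no-prefix (group-spec 0 σ)
  where
  no-prefix : ∀ {w bs} → (σ ≡ w ++ flatten bs) × All (_≤ 0) w × Decomp 0 bs → σ ≡ flatten bs
  no-prefix {[]}    (e , _ , _)       = e
  no-prefix {x ∷ _} (e , x≤0 ∷ _ , _) =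
    ⊥-elim (<⇒≱ (proj₁ (perm-range p (subst (x ∈_) (sym e) (here refl)))) x≤0)

blocks-decomp : ∀ σ → Decomp 0 (blocks σ)
blocks-decomp σ = proj₂ (proj₂ (group-spec 0 σ))

-- The last left-to-right maximum of a permutation is its size.
perm-lastMax : ∀ {σ} bs → IsPerm σ → σ ≡ flatten bs → Decomp 0 bs → lastMax 0 bs ≡ length σ
perm-lastMax []       _ e _ = sym (cong length e)
perm-lastMax {σ} (b ∷ bs) p e d = ≤-antisym
  (proj₂ (perm-range p (subst (_ ∈_) (sym e) (lastMax-∈ 0 b bs))))
  (All.lookup (lastMax-bounds d) (subst (length σ ∈_) e (perm-max p nonempty)))
  where
  nonempty : 1 ≤ length σ
  nonempty = subst (1 ≤_) (sym (cong length e)) (s≤s z≤n)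

-- ... and so is the reach, because |σ| - 1 is an entry other than the last maximum.
perm-reach : ∀ {σ} b bs → IsPerm σ → σ ≡ flatten (b ∷ bs) → Decomp 0 (b ∷ bs) →
  reach 0 (b ∷ bs) ≡ length σ
perm-reach {σ} b bs p e d =
  ≤-antisym (subst (reach 0 (b ∷ bs) ≤_) last≡size (reach-≤ d)) (size≤reach (length σ) refl)
  where
  last≡size : lastMax 0 (b ∷ bs) ≡ length σ
  last≡size = perm-lastMax (b ∷ bs) p e d
  size≤reach : ∀ n → length σ ≡ n → n ≤ reach 0 (b ∷ bs)
  size≤reach zero          _    = z≤n
  size≤reach (suc zero)    _    = reach-> d
  size≤reach (suc (suc m)) size = below-reach d (subst (suc m ∈_) e (perm-complete p m<σ)) m≢last
    where
    m<σ : m < length σ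
    m<σ = <-trans (n<1+n m) (≤-reflexive (sym size))
    m≢last : suc m ≢ lastMax 0 (b ∷ bs)
    m≢last m≡last = 1+n≢n (sym (trans (trans m≡last last≡size) size))

-- (6) The path statistic of Φ₁

inAv-admissible : ∀ {σ} → InAvT₁ σ → Admissible σ
inAv-admissible (p , no3214 ∷ _ ∷ no4213 ∷ _ ∷ []) =
  record { distinct = perm-unique p ; no3214 = no3214 ; no4213 = no4213 }

asc-Φ₁ : ∀ σ → InAvT₁ σ → asc σ ≡ pathAsc (length σ) peak (Φ₁ σ)
asc-Φ₁ σ inAv@(p , _) = begin
  asc σ                                        ≡⟨ cong asc e ⟩
  asc (flatten bs)                             ≡⟨ sym (asc-pathAsc bs d (subst Admissible e (inAv-admissible inAv))) ⟩
  pathAsc (lastMax 0 bs) peak (phiBlocks 0 bs) ≡⟨ cong (λ c → pathAsc c peak (phiBlocks 0 bs)) (perm-lastMax bs p e d) ⟩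
  pathAsc (length σ) peak (Φ₁ σ)               ∎
  where
  open ≡-Reasoning
  bs = blocks σ
  e = perm-blocks p
  d = blocks-decomp σ

Φ₁-length : ∀ σ → 1 ≤ length σ → InAvT₁ σ → length (Φ₁ σ) + 2 ≡ length σ + length σ
Φ₁-length σ len (p , _) = from-blocks (blocks σ) (perm-blocks p) (blocks-decomp σ)
  where
  open ≡-Reasoning
  from-blocks : ∀ bs → σ ≡ flatten bs → Decomp 0 bs → length (phiBlocks 0 bs) + 2 ≡ length σ + length σ
  from-blocks []       e _ = ⊥-elim (<⇒≱ len (≤-reflexive (cong length e)))
  from-blocks (b ∷ bs) e d = begin
    length (phiBlocks 0 (b ∷ bs)) + 2            ≡⟨ cong (_+ 2) (sym (+-identityʳ _)) ⟩
    length (phiBlocks 0 (b ∷ bs)) + 0 + 2        ≡⟨ phiBlocks-length b bs d ⟩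
    reach 0 (b ∷ bs) + length (flatten (b ∷ bs)) ≡⟨ cong₂ _+_ (perm-reach b bs p e d) (cong length (sym e)) ⟩
    length σ + length σ                          ∎

double-injective : ∀ m n → m + m ≡ n + n → m ≡ n
double-injective m n m+m≡n+n with <-cmp m n
... | tri< m<n _ _ = ⊥-elim (<-irrefl m+m≡n+n (+-mono-< m<n m<n))
... | tri≈ _ m≡n _ = m≡n
... | tri> _ _ n<m = ⊥-elim (<-irrefl (sym m+m≡n+n) (+-mono-< n<m n<m))

factor-sizes : ∀ {s t u c} (P′ P″ : List Step) → length P′ ≡ u + u →
  length (P′ ++ P″) + 2 ≡ s + s → length P′ + 2 ≡ t + t → length P″ + 2 ≡ suc c + suc c →
  t ≡ suc u × s ≡ suc (u + c)
factor-sizes {s} {t} {u} {c} P′ P″ P′≡ σ-eq τ-eq ρ-eq =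
  double-injective t (suc u) (begin
    t + t                  ≡⟨ sym τ-eq ⟩
    length P′ + 2          ≡⟨ cong (_+ 2) P′≡ ⟩
    u + u + 2              ≡⟨ regroup₁ u ⟩
    suc u + suc u          ∎)
  , double-injective s (suc (u + c)) (begin
    s + s                                ≡⟨ sym σ-eq ⟩
    length (P′ ++ P″) + 2                ≡⟨ cong (_+ 2) (length-++ P′) ⟩
    length P′ + length P″ + 2            ≡⟨ +-assoc (length P′) (length P″) 2 ⟩
    length P′ + (length P″ + 2)          ≡⟨ cong₂ _+_ P′≡ ρ-eq ⟩
    u + u + (suc c + suc c)              ≡⟨ regroup₂ u c ⟩
    suc (u + c) + suc (u + c)            ∎)
  where
  open ≡-Reasoning
  regroup₁ : ∀ u → u + u + 2 ≡ suc u + suc u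
  regroup₁ = solve-∀
  regroup₂ : ∀ u c → u + u + (suc c + suc c) ≡ suc (u + c) + suc (u + c)
  regroup₂ = solve-∀

proposition13 : (σ τ ρ : List ℕ) (P′ P″ : List Step)
    → 1 ≤ length σ → InAvT₁ σ
    → IsDyckPath P′ → 1 ≤ length P′ → IsDyckPrefix P″
    → Φ₁ σ ≡ P′ ++ P″
    → 1 ≤ length τ → InAvT₁ τ → Φ₁ τ ≡ P′
    → 1 ≤ length ρ → InAvT₁ ρ → Φ₁ ρ ≡ P″
    → asc σ ≡ asc τ + asc ρ
proposition13 σ τ ρ P′ P″ σ-size σ-av P′-dyck _ P″-prefix Φσ τ-size τ-av Φτ ρ-size ρ-av Φρ = begin
  asc σ
    ≡⟨ asc-Φ₁ σ σ-av ⟩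
  pathAsc (length σ) peak (Φ₁ σ)
    ≡⟨ cong₂ (λ n P → pathAsc n peak P) |σ| Φσ ⟩
  pathAsc (suc (u + c)) peak (P′ ++ P″)
    ≡⟨ pathAsc-++ P′ c peak (prefix-startsUp P″-prefix) ⟩
  pathAsc (suc u) peak P′ + pathAsc (suc c) peak P″
    ≡⟨ sym (cong₂ _+_ (cong₂ (λ n P → pathAsc n peak P) |τ| Φτ)
                      (cong₂ (λ n P → pathAsc n peak P) |ρ| Φρ)) ⟩
  pathAsc (length τ) peak (Φ₁ τ) + pathAsc (length ρ) peak (Φ₁ ρ)
    ≡⟨ sym (cong₂ _+_ (asc-Φ₁ τ τ-av) (asc-Φ₁ ρ ρ-av)) ⟩
  asc τ + asc ρ
    ∎
  where
  open ≡-Reasoning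
  u = ups P′
  c = length ρ ∸ 1
  |ρ| : length ρ ≡ suc c
  |ρ| = sym (m+[n∸m]≡n ρ-size)
  path-length : ∀ {π P} → 1 ≤ length π → InAvT₁ π → Φ₁ π ≡ P → length P + 2 ≡ length π + length π
  path-length {π} size av refl = Φ₁-length π size av
  sizes : length τ ≡ suc u × length σ ≡ suc (u + c)
  sizes = factor-sizes P′ P″ (dyck-length P′-dyck) (path-length σ-size σ-av Φσ) (path-length τ-size τ-av Φτ)
            (subst (λ n → length P″ + 2 ≡ n + n) |ρ| (path-length ρ-size ρ-av Φρ))
  |τ| = proj₁ sizes
  |σ| = proj₂ sizes
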